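{- If $\varphi\vdash\psi$ is an $\mathcal{L}$-sequent which is not derivable in $\mathbf{L}$, then $\mathbb{M}\not\models \varphi\vdash\psi$, where $\mathbb{M}$ is the canonical model of $\mathbf{L}$.
   Context: The language $\mathcal{L}$ over a set $\mathsf{Prop}$ of atoms and a finite set $\mathsf{Ag}$ of agents is $\varphi ::= \bot \mid \top \mid p \mid \varphi\wedge\varphi \mid \varphi\vee\varphi \mid \Box_i\varphi$. The logic $\mathbf{L}$ is the set of sequents containing $p\vdash p$, $\bot\vdash p$, $p\vdash\top$, $p\vdash p\vee q$, $q\vdash p\vee q$, $p\wedge q\vdash p$, $p\wedge q\vdash q$, $\top\vdash\Box_i\top$, $\Box_i p\wedge\Box_i q\vdash\Box_i(p\wedge q)$, and closed under cut, uniform substitution, the rules "from $\chi\vdash\phi$ and $\chi\vdash\psi$ infer $\chi\vdash\phi\wedge\psi$", "from $\phi\vdash\chi$ and $\psi\vdash\chi$ infer $\phi\vee\psi\vdash\chi$", and "from $\phi\vdash\psi$ infer $\Box_i\phi\vdash\Box_i\psi$". For $S\subseteq A\times X$ let $S^{\uparrow}[B]=\{x\mid \forall a\in B,\ aSx\}$ and $S^{\downarrow}[Y]=\{a\mid \forall x\in Y,\ aSx\}$; write $B^\uparrow=I^\uparrow[B]$, $Y^\downarrow=I^\downarrow[Y]$. A model $\mathbb{M}=((A,X,I),\{R_i\}_{i\in\mathsf{Ag}},V)$ assigns to each atom $p$ a formal concept $([\![p]\!],(\![p]\!))$, i.e. $[\![p]\!]\subseteq A$ (extension), $(\![p]\!)\subseteq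 X$ (description), $[\![p]\!]^\uparrow=(\![p]\!)$, $(\![p]\!)^\downarrow=[\![p]\!]$. This extends to all formulas by $[\![\top]\!]=A$, $(\![\bot]\!)=X$, $[\![\phi\wedge\psi]\!]=[\![\phi]\!]\cap[\![\psi]\!]$, $(\![\phi\vee\psi]\!)=(\![\phi]\!)\cap(\![\psi]\!)$, $[\![\Box_i\phi]\!]=R_i^{\downarrow}[(\![\phi]\!)]$, with in each case the description being the $\uparrow$ of the extension, resp. the extension being the $\downarrow$ of the description. $\mathbb{M}\models\phi\vdash\psi$ iff $[\![\phi]\!]\subseteq[\![\psi]\!]$. The canonical model: take the Lindenbaum–Tarski algebra $\mathbb{L}$ of $\mathbf{L}$; $A$ is the set of its lattice filters, $X$ the set of its lattice ideals, $aIx$ iff $a\cap x\neq\varnothing$, $aR_ix$ iff $\Box_i u\in a$ for some $u\in x$; the valuation sets $[\![p]\!]$ (resp. $(\![p]\!)$) to be the set of filters (resp. ideals) containing $p$. -}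

module Defs where

open import Level using (Level; Lift; lift; lower) renaming (suc to lsuc; zero to lzero)
open import Data.Nat using (ℕ)
open import Data.Fin using (Fin)
open import Data.Unit using (⊤; tt)
open import Data.Product using (Σ; _×_; _,_; proj₁; proj₂)
open import Relation.Unary using (Pred; _⊆_; _≐_; _∩_)

-- Syntax: formulas over atoms P and agents Ag = Fin n (a finite set)

infixr 7 _∧'_
infixr 6 _∨'_
infix 4 _⊢_

data Fm (P : Set) (n : ℕ) : Set where
  ⊥' ⊤' : Fm P n
  at    : P → Fm P n
  _∧'_  : Fm P n → Fm P n → Fm P n
  _∨'_  : Fm P n → Fm P n → Fm P n
  □     : Fin n → Fm P n → Fm P n

_[_] : ∀ {P n} → Fm P n → (P → Fm P n) → Fm P n
⊥' [ σ ] = ⊥'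
⊤' [ σ ] = ⊤'
at p [ σ ] = σ p
(φ ∧' ψ) [ σ ] = (φ [ σ ]) ∧' (ψ [ σ ])
(φ ∨' ψ) [ σ ] = (φ [ σ ]) ∨' (ψ [ σ ])
□ i φ [ σ ] = □ i (φ [ σ ])

-- The logic L: least set of sequents containing the axioms (stated as
-- schemata, i.e. already closed under substitution instances) and closed
-- under cut, uniform substitution and the three rules.

data _⊢_ {P : Set} {n : ℕ} : Fm P n → Fm P n → Set where
  ax-id  : ∀ {φ} → φ ⊢ φ
  ax-⊥   : ∀ {φ} → ⊥' ⊢ φ
  ax-⊤   : ∀ {φ} → φ ⊢ ⊤'
  ax-∨₁  : ∀ {φ ψ} → φ ⊢ φ ∨' ψ
  ax-∨₂  : ∀ {φ ψ} → ψ ⊢ φ ∨' ψ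
  ax-∧₁  : ∀ {φ ψ} → φ ∧' ψ ⊢ φ
  ax-∧₂  : ∀ {φ ψ} → φ ∧' ψ ⊢ ψ
  ax-□⊤  : ∀ {i} → ⊤' ⊢ □ i ⊤'
  ax-□∧  : ∀ {i φ ψ} → □ i φ ∧' □ i ψ ⊢ □ i (φ ∧' ψ)
  cut    : ∀ {φ χ ψ} → φ ⊢ χ → χ ⊢ ψ → φ ⊢ ψ
  usubst : ∀ {φ ψ} (σ : P → Fm P n) → φ ⊢ ψ → φ [ σ ] ⊢ ψ [ σ ]
  ∧-I    : ∀ {χ φ ψ} → χ ⊢ φ → χ ⊢ ψ → χ ⊢ φ ∧' ψ
  ∨-E    : ∀ {φ ψ χ} → φ ⊢ χ → ψ ⊢ χ → φ ∨' ψ ⊢ χ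
  □-mono : ∀ {i φ ψ} → φ ⊢ ψ → □ i φ ⊢ □ i ψ

module _ {ℓ : Level} {A X : Set ℓ} where
  _↑[_] : (A → X → Set ℓ) → Pred A ℓ → Pred X ℓ
  S ↑[ B ] = λ x → ∀ a → B a → S a x

  _↓[_] : (A → X → Set ℓ) → Pred X ℓ → Pred A ℓ
  S ↓[ Y ] = λ a → ∀ x → Y x → S a x

record Model (P : Set) (n : ℕ) (ℓ : Level) : Set (lsuc ℓ) where
  field
    A    : Set ℓ
    X    : Set ℓ
    I    : A → X → Set ℓ
    R    : Fin n → A → X → Set ℓ
    Vext  : P → Pred A ℓ
    Vdesc : P → Pred X ℓ
    -- each atom is assigned a formal concept
    concept↑ : ∀ p → I ↑[ Vext p ] ≐ Vdesc p
    concept↓ : ∀ p → I ↓[ Vdesc p ] ≐ Vext p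

module _ {P : Set} {n : ℕ} {ℓ : Level} (M : Model P n ℓ) where
  open Model M

  All : ∀ {B : Set ℓ} → Pred B ℓ
  All = λ _ → Lift ℓ ⊤

  mutual
    ext : Fm P n → Pred A ℓ
    ext ⊥' = I ↓[ All ]
    ext ⊤' = All
    ext (at p) = Vext p
    ext (φ ∧' ψ) = ext φ ∩ ext ψ
    ext (φ ∨' ψ) = I ↓[ desc φ ∩ desc ψ ]
    ext (□ i φ) = R i ↓[ desc φ ]

    desc : Fm P n → Pred X ℓ
    desc ⊥' = All
    desc ⊤' = I ↑[ All ]
    desc (at p) = Vdesc p
    desc (φ ∧' ψ) = I ↑[ ext φ ∩ ext ψ ]
    desc (φ ∨' ψ) = desc φ ∩ desc ψ
    desc (□ i φ) = I ↑[ R i ↓[ desc φ ] ]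

  _⊨_⊢_ : Fm P n → Fm P n → Set ℓ
  _⊨_⊢_ φ ψ = ext φ ⊆ ext ψ

-- Lindenbaum–Tarski algebra: formulas modulo interderivability, ordered
-- by ⊢.  A lattice filter (resp. ideal) of it is represented by the set of
-- formulas whose class belongs to it.

record Filter (P : Set) (n : ℕ) : Set₁ where
  field
    mem  : Fm P n → Set
    has⊤ : mem ⊤'
    up   : ∀ {φ ψ} → φ ⊢ ψ → mem φ → mem ψ
    meet : ∀ {φ ψ} → mem φ → mem ψ → mem (φ ∧' ψ)

record Ideal (P : Set) (n : ℕ) : Set₁ where
  field
    mem  : Fm P n → Set
    has⊥ : mem ⊥'
    down : ∀ {φ ψ} → φ ⊢ ψ → mem ψ → mem φ
    join : ∀ {φ ψ} → mem φ → mem ψ → mem (φ ∨' ψ)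

open Filter renaming (mem to memF)
open Ideal renaming (mem to memI)

principalF : ∀ {P n} → Fm P n → Filter P n
principalF φ = record
  { mem = λ ψ → φ ⊢ ψ ; has⊤ = ax-⊤ ; up = λ d e → cut e d ; meet = ∧-I }

principalI : ∀ {P n} → Fm P n → Ideal P n
principalI φ = record
  { mem = λ ψ → ψ ⊢ φ ; has⊥ = ax-⊥ ; down = cut ; join = ∨-E }

CanI : ∀ {P n} → Filter P n → Ideal P n → Set₁
CanI a x = Lift (lsuc lzero) (Σ _ λ φ → memF a φ × memI x φ)

CanR : ∀ {P n} → Fin n → Filter P n → Ideal P n → Set₁
CanR i a x = Lift (lsuc lzero) (Σ _ λ u → memI x u × memF a (□ i u))

canonical : (P : Set) (n : ℕ) → Model P n (lsuc lzero)
canonical P n = record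
  { A = Filter P n
  ; X = Ideal P n
  ; I = CanI
  ; R = CanR
  ; Vext = λ p a → Lift _ (memF a (at p))
  ; Vdesc = λ p x → Lift _ (memI x (at p))
  ; concept↑ = λ p →
      (λ {x} h → let (φ , pφ , xφ) = lower (h (principalF (at p)) (lift ax-id))
                 in lift (down x pφ xφ))
    , (λ {x} xp a ap → lift (at p , lower ap , lower xp))
  ; concept↓ = λ p →
      (λ {a} h → let (φ , aφ , φp) = lower (h (principalI (at p)) (lift ax-id))
                 in lift (up a φp aφ))
    , (λ {a} ap x xp → lift (at p , lower ap , lower xp))
  }

module Submission where

-- The heart of the proof is the truth lemma for the canonical model: for
-- every formula φ, a filter lies in the extension [[φ]] iff it contains φ,
-- and an ideal lies in the description (φ) iff it contains φ.  The non-trivial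
-- directions (semantic ⇒ membership) all follow one pattern: test the
-- semantic condition against a principal ideal (or filter) generated by φ,
-- which meets the given filter (or ideal) in some formula χ; derivability
-- of χ ⊢ φ (or φ ⊢ χ) then transfers membership along the order.
-- Applying the truth lemma to the principal filter of φ shows that every
-- sequent valid in the canonical model is derivable; Proposition A.19 is
-- the contrapositive.

open import Defs
open import Data.Nat using (ℕ)
open import Relation.Nullary using (¬_)
open import Level using (lift; lower; 0ℓ) renaming (suc to lsuc)
open import Data.Product using (_,_)
open import Data.Unit using (tt)
open Filter renaming (mem to memF)
open Ideal renaming (mem to memI)

module Canonical {P : Set} {n : ℕ} where

  M : Model P n (lsuc 0ℓ)
  M = canonical P n

  meets-principalI : ∀ (a : Filter P n) φ → CanI a (principalI φ) → memF a φ
  meets-principalI a φ (lift (χ , aχ , χ⊢φ)) = up a χ⊢φ aχ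

  meets-principalF : ∀ φ (x : Ideal P n) → CanI (principalF φ) x → memI x φ
  meets-principalF φ x (lift (χ , φ⊢χ , xχ)) = down x φ⊢χ xχ

  boxes-principalI : ∀ i (a : Filter P n) φ → CanR i a (principalI φ) → memF a (□ i φ)
  boxes-principalI i a φ (lift (u , u⊢φ , a□u)) = up a (□-mono u⊢φ) a□u

  mutual
    ext⇒mem : ∀ φ (a : Filter P n) → ext M φ a → memF a φ
    ext⇒mem ⊥' a h = meets-principalI a ⊥' (h (principalI ⊥') (lift tt))
    ext⇒mem ⊤' a h = has⊤ a
    ext⇒mem (at p) a h = lower h
    ext⇒mem (φ ∧' ψ) a (hφ , hψ) = meet a (ext⇒mem φ a hφ) (ext⇒mem ψ a hψ)
    ext⇒mem (φ ∨' ψ) a h =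
      meets-principalI a (φ ∨' ψ)
        (h (principalI (φ ∨' ψ)) (mem⇒desc φ _ ax-∨₁ , mem⇒desc ψ _ ax-∨₂))
    ext⇒mem (□ i φ) a h =
      boxes-principalI i a φ (h (principalI φ) (mem⇒desc φ _ ax-id))

    mem⇒ext : ∀ φ (a : Filter P n) → memF a φ → ext M φ a
    mem⇒ext ⊥' a aφ x _ = lift (⊥' , aφ , has⊥ x)
    mem⇒ext ⊤' a aφ = lift tt
    mem⇒ext (at p) a aφ = lift aφ
    mem⇒ext (φ ∧' ψ) a aφψ = mem⇒ext φ a (up a ax-∧₁ aφψ) , mem⇒ext ψ a (up a ax-∧₂ aφψ)
    mem⇒ext (φ ∨' ψ) a aφψ x (hφ , hψ) =
      lift (φ ∨' ψ , aφψ , join x (desc⇒mem φ x hφ) (desc⇒mem ψ x hψ))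
    mem⇒ext (□ i φ) a a□φ x h = lift (φ , desc⇒mem φ x h , a□φ)

    desc⇒mem : ∀ φ (x : Ideal P n) → desc M φ x → memI x φ
    desc⇒mem ⊥' x h = has⊥ x
    desc⇒mem ⊤' x h = meets-principalF ⊤' x (h (principalF ⊤') (lift tt))
    desc⇒mem (at p) x h = lower h
    desc⇒mem (φ ∧' ψ) x h =
      meets-principalF (φ ∧' ψ) x
        (h (principalF (φ ∧' ψ)) (mem⇒ext φ _ ax-∧₁ , mem⇒ext ψ _ ax-∧₂))
    desc⇒mem (φ ∨' ψ) x (hφ , hψ) = join x (desc⇒mem φ x hφ) (desc⇒mem ψ x hψ)
    desc⇒mem (□ i φ) x h =
      meets-principalF (□ i φ) x (h (principalF (□ i φ)) ↑□φ-in-ext)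
      where
        ↑□φ-in-ext : ext M (□ i φ) (principalF (□ i φ))
        ↑□φ-in-ext y hy = lift (φ , desc⇒mem φ y hy , ax-id)

    mem⇒desc : ∀ φ (x : Ideal P n) → memI x φ → desc M φ x
    mem⇒desc ⊥' x xφ = lift tt
    mem⇒desc ⊤' x xφ a _ = lift (⊤' , has⊤ a , xφ)
    mem⇒desc (at p) x xφ = lift xφ
    mem⇒desc (φ ∧' ψ) x xφψ a (hφ , hψ) =
      lift (φ ∧' ψ , meet a (ext⇒mem φ a hφ) (ext⇒mem ψ a hψ) , xφψ)
    mem⇒desc (φ ∨' ψ) x xφψ = mem⇒desc φ x (down x ax-∨₁ xφψ) , mem⇒desc ψ x (down x ax-∨₂ xφψ)
    mem⇒desc (□ i φ) x x□φ a h = lift (□ i φ , ext⇒mem (□ i φ) a h , x□φ)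

  valid⇒derivable : ∀ φ ψ → M ⊨ φ ⊢ ψ → φ ⊢ ψ
  valid⇒derivable φ ψ valid =
    ext⇒mem ψ (principalF φ) (valid (mem⇒ext φ (principalF φ) ax-id))

propositionA19 : {P : Set} {n : ℕ} (φ ψ : Fm P n) →
    ¬ (φ ⊢ ψ) → ¬ (_⊨_⊢_ (canonical P n) φ ψ)
propositionA19 φ ψ underivable valid =
  underivable (Canonical.valid⇒derivable φ ψ valid)
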